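{- Let $k$ be a positive integer, let $G_1,G_2$ be disjoint copies of $C_{3k+1}$, and let $f:V(G_1)\to V(G_2)$ be any function. Then $\gamma(C(C_{3k+1},f))<2\gamma(C_{3k+1})$.
   Context: For disjoint copies $G_1,G_2$ of a graph $G$ and a function $f:V(G_1)\to V(G_2)$, the functigraph $C(G,f)$ has vertex set $V(G_1)\cup V(G_2)$ and edge set $E(G_1)\cup E(G_2)\cup\{uv : u\in V(G_1), v\in V(G_2), v=f(u)\}$. $\gamma$ denotes domination number; $\gamma(C_n)=\lceil n/3\rceil$. -}

module Defs where

open import Data.Nat using (ℕ; zero; suc; _+_; _*_; _<_; _≤_)
open import Data.Fin using (Fin; toℕ; splitAt; _↑ˡ_; _↑ʳ_)
open import Data.Nat.DivMod using (_%_)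
open import Data.Sum using (_⊎_; inj₁; inj₂)
open import Data.Product using (Σ; _×_; ∃-syntax)
open import Data.Empty using (⊥)
open import Data.List using (List; length)
open import Data.List.Membership.Propositional using (_∈_)
open import Data.List.Relation.Unary.Unique.Propositional using (Unique)
open import Relation.Binary.PropositionalEquality using (_≡_)
open import Relation.Nullary using (¬_)

record Graph (n : ℕ) : Set₁ where
  field
    Adj : Fin n → Fin n → Set

open Graph public

-- The cycle C_n on vertices 0,…,n-1: i ~ j iff j ≡ i+1 (mod n) or i ≡ j+1 (mod n).
-- (Intended for n ≥ 3.)
Cycle : (n : ℕ) → Graph n
Adj (Cycle zero) i j = ⊥
Adj (Cycle n@(suc _)) i j =
  (toℕ j ≡ suc (toℕ i) % n) ⊎ (toℕ i ≡ suc (toℕ j) % n)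

-- The functigraph C(G,f): vertices Fin (n + n); the first n (via _↑ˡ_) form
-- the copy G₁, the last n (via _↑ʳ_) form the copy G₂.  Edges: edges of G₁,
-- edges of G₂, and u₁ — f(u)₂ for every u.
Functigraph : {n : ℕ} → Graph n → (Fin n → Fin n) → Graph (n + n)
Adj (Functigraph {n} G f) x y with splitAt n x | splitAt n y
... | inj₁ u | inj₁ v = Adj G u v
... | inj₂ u | inj₂ v = Adj G u v
... | inj₁ u | inj₂ v = v ≡ f u
... | inj₂ u | inj₁ v = u ≡ f v

Dominating : {n : ℕ} → Graph n → List (Fin n) → Set
Dominating {n} G D = (x : Fin n) → (x ∈ D) ⊎ (∃[ d ] (d ∈ D × Adj G x d))

HasDomSetOfSize : {n : ℕ} → Graph n → ℕ → Set
HasDomSetOfSize G m = ∃[ D ] (Unique D × Dominating G D × length D ≡ m)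

IsDominationNumber : {n : ℕ} → Graph n → ℕ → Set
IsDominationNumber G m =
  HasDomSetOfSize G m × ((m' : ℕ) → m' < m → ¬ HasDomSetOfSize G m')

-- In G₁ the vertices 1, 4, …, 3m−2 of C_{3m+1} (m = k+1) dominate everything except
-- the last vertex u. In G₂, rotating the set {0, 1, 4, …, 3m−2} gives a dominating set
-- of size m+1 through any prescribed vertex, in particular through f(u), which then
-- dominates u across the matching edge. So γ(C(C_{3m+1},f)) ≤ 2m+1, whereas every
-- dominating set of C_{3m+1} has more than m vertices, each covering at most three.
module Submission where

open import Defs
open import Data.Nat using (ℕ; suc; _+_; _*_; _<_)
open import Data.Fin using (Fin)

open import Data.Nat using (zero; _≤_; s≤s; s≤s⁻¹)
open import Data.Nat.Properties
open import Data.Nat.DivMod using (_%_; m%n<n; n%n≡0; m<n⇒m%n≡m)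
open import Data.Fin as Fin using (toℕ; fromℕ; fromℕ<; inject₁; splitAt; join; _↑ˡ_; _↑ʳ_)
open import Data.Fin.Properties
  using (toℕ-fromℕ<; toℕ-fromℕ; toℕ-inject₁; toℕ-injective; toℕ<n; injective⇒≤;
         splitAt-↑ˡ; splitAt-↑ʳ; join-splitAt; ↑ˡ-injective; ↑ʳ-injective)
open import Relation.Nullary using (¬_)
open import Data.Sum using (_⊎_; inj₁; inj₂)
open import Data.Product using (_×_; _,_; ∃-syntax)
open import Data.List using (List; []; _∷_; length; map; _++_; lookup; tabulate)
open import Data.List.Properties using (length-map; length-++; length-tabulate)
open import Data.List.Membership.Propositional using (_∈_)
open import Data.List.Membership.Propositional.Properties using (∈-map⁺; ∈-map⁻; ∈-++⁺ˡ; ∈-++⁺ʳ; ∈-tabulate⁺)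
open import Data.List.Relation.Unary.Any using (here)
open import Data.List.Relation.Unary.Any.Properties using (lookup-index)
import Data.List.Relation.Unary.All.Properties as All
open import Data.List.Relation.Unary.AllPairs using (_∷_)
open import Data.List.Relation.Unary.Unique.Propositional using (Unique)
import Data.List.Relation.Unary.Unique.Propositional.Properties as Unique
open import Relation.Binary.PropositionalEquality using (_≡_; _≢_; refl; sym; trans; cong; cong₂; subst; module ≡-Reasoning)

enumeration⇒n≤length : ∀ {n} (xs : List (Fin n)) → (∀ x → x ∈ xs) → n ≤ length xs
enumeration⇒n≤length xs _∈xs = injective⇒≤ λ {x} {y} same-index →
  trans (lookup-index (x ∈xs)) (trans (cong (lookup xs) same-index) (sym (lookup-index (y ∈xs))))

Dominated : {n : ℕ} → Graph n → List (Fin n) → Fin n → Set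
Dominated G D x = (x ∈ D) ⊎ (∃[ d ] (d ∈ D × Adj G x d))

HasDomSetOfSizeThrough : {n : ℕ} → Graph n → ℕ → Fin n → Set
HasDomSetOfSizeThrough G m x = ∃[ D ] (Unique D × Dominating G D × length D ≡ m × x ∈ D)

domination-number-≤ : ∀ {n} {G : Graph n} {a s} → IsDominationNumber G a → HasDomSetOfSize G s → a ≤ s
domination-number-≤ (_ , minimal) domSet = ≮⇒≥ λ s<a → minimal _ s<a domSet

module _ {n₁ n₂ : ℕ} {G : Graph n₁} {H : Graph n₂} {g : Fin n₁ → Fin n₂}
         (g-Adj : ∀ {x y} → Adj G x y → Adj H (g x) (g y)) where

  Dominated-map : ∀ {D x} → Dominated G D x → Dominated H (map g D) (g x)
  Dominated-map (inj₁ x∈D)              = inj₁ (∈-map⁺ g x∈D)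
  Dominated-map (inj₂ (d , d∈D , x~d)) = inj₂ (g d , ∈-map⁺ g d∈D , g-Adj x~d)

module _ {n : ℕ} {G : Graph n} where

  Dominated-++ˡ : ∀ {D x} E → Dominated G D x → Dominated G (D ++ E) x
  Dominated-++ˡ E (inj₁ x∈D)              = inj₁ (∈-++⁺ˡ x∈D)
  Dominated-++ˡ E (inj₂ (d , d∈D , x~d)) = inj₂ (d , ∈-++⁺ˡ d∈D , x~d)

  Dominated-++ʳ : ∀ {D x} E → Dominated G D x → Dominated G (E ++ D) x
  Dominated-++ʳ E (inj₁ x∈D)              = inj₁ (∈-++⁺ʳ E x∈D)
  Dominated-++ʳ E (inj₂ (d , d∈D , x~d)) = inj₂ (d , ∈-++⁺ʳ E d∈D , x~d)

  automorphism-HasDomSetOfSizeThrough :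
    (σ σ⁻¹ : Fin n → Fin n) → (∀ y → σ (σ⁻¹ y) ≡ y) → (∀ {x y} → σ x ≡ σ y → x ≡ y) →
    (∀ {x y} → Adj G x y → Adj G (σ x) (σ y)) →
    ∀ {s x} → HasDomSetOfSizeThrough G s x → HasDomSetOfSizeThrough G s (σ x)
  automorphism-HasDomSetOfSizeThrough σ σ⁻¹ σ-σ⁻¹ σ-injective σ-Adj (D , unique , dom , len , x∈D) =
    map σ D , Unique.map⁺ σ-injective unique , dom′ , trans (length-map σ D) len , ∈-map⁺ σ x∈D
    where
    dom′ : Dominating G (map σ D)
    dom′ y = subst (Dominated G (map σ D)) (σ-σ⁻¹ y) (Dominated-map {H = G} σ-Adj (dom (σ⁻¹ y)))

data Mod3 : ℕ → Set where
  triple   : ∀ q → Mod3 (3 * q)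
  triple+1 : ∀ q → Mod3 (suc (3 * q))
  triple+2 : ∀ q → Mod3 (suc (suc (3 * q)))

mod3 : ∀ j → Mod3 j
mod3 0 = triple 0
mod3 1 = triple+1 0
mod3 2 = triple+2 0
mod3 (suc (suc (suc j))) with mod3 j
... | triple q   = subst Mod3 (*-suc 3 q) (triple (suc q))
... | triple+1 q = subst Mod3 (cong suc (*-suc 3 q)) (triple+1 (suc q))
... | triple+2 q = subst Mod3 (cong (λ i → suc (suc i)) (*-suc 3 q)) (triple+2 (suc q))

module CycleGraph (n : ℕ) where

  N : ℕ
  N = suc n

  next : Fin N → Fin N
  next i = fromℕ< (m%n<n (suc (toℕ i)) N)

  toℕ-next : ∀ i → toℕ (next i) ≡ suc (toℕ i) % N
  toℕ-next i = toℕ-fromℕ< (m%n<n (suc (toℕ i)) N)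

  prev : Fin N → Fin N
  prev Fin.zero    = fromℕ n
  prev (Fin.suc i) = inject₁ i

  next-prev : ∀ x → next (prev x) ≡ x
  next-prev Fin.zero = toℕ-injective (begin
    toℕ (next (fromℕ n))     ≡⟨ toℕ-next (fromℕ n) ⟩
    suc (toℕ (fromℕ n)) % N  ≡⟨ cong (λ j → suc j % N) (toℕ-fromℕ n) ⟩
    N % N                    ≡⟨ n%n≡0 N ⟩
    0                        ∎)
    where open ≡-Reasoning
  next-prev (Fin.suc i) = toℕ-injective (begin
    toℕ (next (inject₁ i))     ≡⟨ toℕ-next (inject₁ i) ⟩
    suc (toℕ (inject₁ i)) % N  ≡⟨ cong (λ j → suc j % N) (toℕ-inject₁ i) ⟩
    suc (toℕ i) % N            ≡⟨ m<n⇒m%n≡m (s≤s (toℕ<n i)) ⟩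
    suc (toℕ i)                ∎)
    where open ≡-Reasoning

  prev-next : ∀ x → prev (next x) ≡ x
  prev-next x with m≤n⇒m<n∨m≡n (s≤s⁻¹ (toℕ<n x))
  ... | inj₁ x<n = prev-of-successor (next x) (trans (toℕ-next x) (m<n⇒m%n≡m (s≤s x<n)))
    where
    prev-of-successor : ∀ y → toℕ y ≡ suc (toℕ x) → prev y ≡ x
    prev-of-successor (Fin.suc i) eq = toℕ-injective (trans (toℕ-inject₁ i) (suc-injective eq))
  ... | inj₂ x≡n = trans (cong prev next-last) (toℕ-injective (trans (toℕ-fromℕ n) (sym x≡n)))
    where
    next-last : next x ≡ Fin.zero
    next-last = toℕ-injective (trans (toℕ-next x) (trans (cong (λ j → suc j % N) x≡n) (n%n≡0 N)))

  next-injective : ∀ {x y} → next x ≡ next y → x ≡ y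
  next-injective {x} {y} eq = trans (sym (prev-next x)) (trans (cong prev eq) (prev-next y))

  Adj⇒next : ∀ {x y} → Adj (Cycle N) x y → y ≡ next x ⊎ x ≡ next y
  Adj⇒next {x} {y} (inj₁ eq) = inj₁ (toℕ-injective (trans eq (sym (toℕ-next x))))
  Adj⇒next {x} {y} (inj₂ eq) = inj₂ (toℕ-injective (trans eq (sym (toℕ-next y))))

  next⇒Adj : ∀ {x y} → y ≡ next x ⊎ x ≡ next y → Adj (Cycle N) x y
  next⇒Adj {x} (inj₁ refl) = inj₁ (toℕ-next x)
  next⇒Adj {_} {y} (inj₂ refl) = inj₂ (toℕ-next y)

  next-Adj : ∀ {x y} → Adj (Cycle N) x y → Adj (Cycle N) (next x) (next y)
  next-Adj x~y with Adj⇒next x~y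
  ... | inj₁ refl = next⇒Adj (inj₁ refl)
  ... | inj₂ refl = next⇒Adj (inj₂ refl)

  closedNeighbourhoods : List (Fin N) → List (Fin N)
  closedNeighbourhoods D = D ++ map next D ++ map prev D

  length-closedNeighbourhoods : ∀ D → length (closedNeighbourhoods D) ≡ 3 * length D
  length-closedNeighbourhoods D = begin
    length (D ++ map next D ++ map prev D)                  ≡⟨ length-++ D ⟩
    length D + length (map next D ++ map prev D)            ≡⟨ cong (length D +_) (length-++ (map next D)) ⟩
    length D + (length (map next D) + length (map prev D))  ≡⟨ cong (length D +_) (cong₂ _+_ (length-map next D) (length-map prev D)) ⟩
    length D + (length D + length D)                        ≡⟨ cong (λ l → length D + (length D + l)) (sym (+-identityʳ (length D))) ⟩
    3 * length D                                            ∎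
    where open ≡-Reasoning

  Dominated⇒∈closedNeighbourhoods : ∀ {D x} → Dominated (Cycle N) D x → x ∈ closedNeighbourhoods D
  Dominated⇒∈closedNeighbourhoods (inj₁ x∈D) = ∈-++⁺ˡ x∈D
  Dominated⇒∈closedNeighbourhoods {D} {x} (inj₂ (d , d∈D , x~d)) with Adj⇒next x~d
  ... | inj₁ refl = ∈-++⁺ʳ D (∈-++⁺ʳ (map next D) (subst (_∈ map prev D) (prev-next x) (∈-map⁺ prev d∈D)))
  ... | inj₂ refl = ∈-++⁺ʳ D (∈-++⁺ˡ (∈-map⁺ next d∈D))

  Dominating⇒N≤3*length : ∀ {D} → Dominating (Cycle N) D → N ≤ 3 * length D
  Dominating⇒N≤3*length {D} dom = subst (N ≤_) (length-closedNeighbourhoods D)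
    (enumeration⇒n≤length (closedNeighbourhoods D) (λ x → Dominated⇒∈closedNeighbourhoods (dom x)))

  vertex : ℕ → Fin N
  vertex zero    = Fin.zero
  vertex (suc j) = next (vertex j)

  toℕ-vertex : ∀ {j} → j < N → toℕ (vertex j) ≡ j
  toℕ-vertex {zero}  _   = refl
  toℕ-vertex {suc j} j<N = begin
    toℕ (next (vertex j))     ≡⟨ toℕ-next (vertex j) ⟩
    suc (toℕ (vertex j)) % N  ≡⟨ cong (λ i → suc i % N) (toℕ-vertex (<-trans (n<1+n j) j<N)) ⟩
    suc j % N                 ≡⟨ m<n⇒m%n≡m j<N ⟩
    suc j                     ∎
    where open ≡-Reasoning

  vertex-toℕ : ∀ x → vertex (toℕ x) ≡ x
  vertex-toℕ x = toℕ-injective (toℕ-vertex (toℕ<n x))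

  vertex-N : vertex N ≡ Fin.zero
  vertex-N = toℕ-injective (trans (toℕ-next (vertex n))
    (trans (cong (λ i → suc i % N) (toℕ-vertex ≤-refl)) (n%n≡0 N)))

  HasDomSetOfSizeThrough-zero⇒∀ : ∀ {s} → HasDomSetOfSizeThrough (Cycle N) s Fin.zero →
    ∀ x → HasDomSetOfSizeThrough (Cycle N) s x
  HasDomSetOfSizeThrough-zero⇒∀ {s} through-zero x =
    subst (HasDomSetOfSizeThrough (Cycle N) s) (vertex-toℕ x) (through (toℕ x))
    where
    through : ∀ t → HasDomSetOfSizeThrough (Cycle N) s (vertex t)
    through zero    = through-zero
    through (suc t) = automorphism-HasDomSetOfSizeThrough next prev next-prev next-injective next-Adj (through t)

  everyThird : ℕ → List (Fin N)
  everyThird m = tabulate λ (q : Fin m) → vertex (suc (3 * toℕ q))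

  length-everyThird : ∀ m → length (everyThird m) ≡ m
  length-everyThird m = length-tabulate _

  everyThird-∈ : ∀ {m q} → q < m → vertex (suc (3 * q)) ∈ everyThird m
  everyThird-∈ {m} q<m =
    subst (λ j → vertex (suc (3 * j)) ∈ everyThird m) (toℕ-fromℕ< q<m) (∈-tabulate⁺ (fromℕ< q<m))

  module _ {m : ℕ} (n≡3m : n ≡ 3 * m) where

    toℕ-vertex-3q+1 : ∀ {q} → q < m → toℕ (vertex (suc (3 * q))) ≡ suc (3 * q)
    toℕ-vertex-3q+1 {q} q<m =
      toℕ-vertex (subst (λ i → suc (3 * q) < suc i) (sym n≡3m) (s≤s (*-monoʳ-< 3 q<m)))

    everyThird-unique : Unique (everyThird m)
    everyThird-unique = Unique.tabulate⁺ λ {q} {q′} eq →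
      toℕ-injective (*-cancelˡ-≡ _ _ 3 (suc-injective (begin
        suc (3 * toℕ q)                  ≡⟨ sym (toℕ-vertex-3q+1 (toℕ<n q)) ⟩
        toℕ (vertex (suc (3 * toℕ q)))   ≡⟨ cong toℕ eq ⟩
        toℕ (vertex (suc (3 * toℕ q′)))  ≡⟨ toℕ-vertex-3q+1 (toℕ<n q′) ⟩
        suc (3 * toℕ q′)                 ∎)))
      where open ≡-Reasoning

    dominated-by-everyThird : ∀ {j} → Mod3 j → j ≤ 3 * m →
      j ≡ 3 * m ⊎ Dominated (Cycle N) (everyThird m) (vertex j)
    dominated-by-everyThird (triple q) 3q≤3m with m≤n⇒m<n∨m≡n (*-cancelˡ-≤ {q} {m} 3 3q≤3m)
    ... | inj₁ q<m = inj₂ (inj₂ (_ , everyThird-∈ q<m , next⇒Adj (inj₁ refl)))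
    ... | inj₂ q≡m = inj₁ (cong (3 *_) q≡m)
    dominated-by-everyThird (triple+1 q) 3q<3m =
      inj₂ (inj₁ (everyThird-∈ (*-cancelˡ-< 3 q m 3q<3m)))
    dominated-by-everyThird (triple+2 q) 3q+1<3m =
      inj₂ (inj₂ (_ , everyThird-∈ (*-cancelˡ-< 3 q m (<-trans (n<1+n _) 3q+1<3m)) , next⇒Adj (inj₂ refl)))

    everyThird-dominates-but-last : ∀ x → x ≡ vertex n ⊎ Dominated (Cycle N) (everyThird m) x
    everyThird-dominates-but-last x
      with dominated-by-everyThird (mod3 (toℕ x)) (subst (toℕ x ≤_) n≡3m (s≤s⁻¹ (toℕ<n x)))
    ... | inj₁ x≡3m        = inj₁ (trans (sym (vertex-toℕ x)) (cong vertex (trans x≡3m (sym n≡3m))))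
    ... | inj₂ x-dominated = inj₂ (subst (Dominated (Cycle N) (everyThird m)) (vertex-toℕ x) x-dominated)

    HasDomSetOfSizeThrough-zero : HasDomSetOfSizeThrough (Cycle N) (suc m) Fin.zero
    HasDomSetOfSizeThrough-zero =
      Fin.zero ∷ everyThird m , unique , dom , cong suc (length-everyThird m) , here refl
      where
      unique : Unique (Fin.zero ∷ everyThird m)
      unique = All.tabulate⁺ (λ q zero≡ → 0≢1+n (trans (cong toℕ zero≡) (toℕ-vertex-3q+1 (toℕ<n q))))
             ∷ everyThird-unique
      dom : Dominating (Cycle N) (Fin.zero ∷ everyThird m)
      dom x with everyThird-dominates-but-last x
      ... | inj₁ refl        = inj₂ (Fin.zero , here refl , next⇒Adj (inj₁ (sym vertex-N)))
      ... | inj₂ x-dominated = Dominated-++ʳ {G = Cycle N} (Fin.zero ∷ []) x-dominated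

    HasDomSetOfSize⇒m<size : ∀ {s} → HasDomSetOfSize (Cycle N) s → m < s
    HasDomSetOfSize⇒m<size (D , _ , dom , refl) = *-cancelˡ-< 3 m (length D)
      (subst (λ i → suc i ≤ 3 * length D) n≡3m (Dominating⇒N≤3*length dom))

↑ˡ≢↑ʳ : ∀ {n} (u w : Fin n) → u ↑ˡ n ≢ n ↑ʳ w
↑ˡ≢↑ʳ {n} u w eq with trans (sym (splitAt-↑ˡ n u n)) (trans (cong (splitAt n) eq) (splitAt-↑ʳ n n w))
... | ()

module _ {n : ℕ} (G : Graph n) (f : Fin n → Fin n) where

  ↑ˡ-Adj : ∀ {u w} → Adj G u w → Adj (Functigraph G f) (u ↑ˡ n) (w ↑ˡ n)
  ↑ˡ-Adj {u} {w} u~w rewrite splitAt-↑ˡ n u n | splitAt-↑ˡ n w n = u~w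

  ↑ʳ-Adj : ∀ {u w} → Adj G u w → Adj (Functigraph G f) (n ↑ʳ u) (n ↑ʳ w)
  ↑ʳ-Adj {u} {w} u~w rewrite splitAt-↑ʳ n n u | splitAt-↑ʳ n n w = u~w

  ↑ˡ↑ʳ-Adj : ∀ u → Adj (Functigraph G f) (u ↑ˡ n) (n ↑ʳ f u)
  ↑ˡ↑ʳ-Adj u rewrite splitAt-↑ˡ n u n | splitAt-↑ʳ n n (f u) = refl

  HasDomSetOfSize-Functigraph : ∀ {D₁ u s} → Unique D₁ → (∀ x → x ≡ u ⊎ Dominated G D₁ x) →
    HasDomSetOfSizeThrough G s (f u) → HasDomSetOfSize (Functigraph G f) (length D₁ + s)
  HasDomSetOfSize-Functigraph {D₁} {u} {s} unique₁ dom₁ (D₂ , unique₂ , dom₂ , len₂ , fu∈D₂) =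
    D₁′ ++ D₂′ , unique , dom , len
    where
    D₁′ D₂′ : List (Fin (n + n))
    D₁′ = map (_↑ˡ n) D₁
    D₂′ = map (n ↑ʳ_) D₂

    disjoint : ∀ {y} → ¬ (y ∈ D₁′ × y ∈ D₂′)
    disjoint (y∈D₁′ , y∈D₂′) with ∈-map⁻ (_↑ˡ n) y∈D₁′ | ∈-map⁻ (n ↑ʳ_) y∈D₂′
    ... | x , _ , refl | w , _ , eq = ↑ˡ≢↑ʳ x w eq

    unique : Unique (D₁′ ++ D₂′)
    unique = Unique.++⁺ (Unique.map⁺ (↑ˡ-injective n _ _) unique₁)
                        (Unique.map⁺ (↑ʳ-injective n _ _) unique₂) disjoint

    dominated : ∀ side → Dominated (Functigraph G f) (D₁′ ++ D₂′) (join n n side)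
    dominated (inj₁ x) with dom₁ x
    ... | inj₁ refl        = inj₂ (n ↑ʳ f u , ∈-++⁺ʳ D₁′ (∈-map⁺ (n ↑ʳ_) fu∈D₂) , ↑ˡ↑ʳ-Adj u)
    ... | inj₂ x-dominated = Dominated-++ˡ {G = Functigraph G f} D₂′
                               (Dominated-map {G = G} {H = Functigraph G f} ↑ˡ-Adj x-dominated)
    dominated (inj₂ x)     = Dominated-++ʳ {G = Functigraph G f} D₁′
                               (Dominated-map {G = G} {H = Functigraph G f} ↑ʳ-Adj (dom₂ x))

    dom : Dominating (Functigraph G f) (D₁′ ++ D₂′)
    dom x = subst (Dominated (Functigraph G f) (D₁′ ++ D₂′)) (join-splitAt n n x) (dominated (splitAt n x))

    len : length (D₁′ ++ D₂′) ≡ length D₁ + s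
    len = trans (length-++ D₁′) (cong₂ _+_ (length-map (_↑ˡ n) D₁) (trans (length-map (n ↑ʳ_) D₂) len₂))

proposition4p1 : (k : ℕ) → (f : Fin (3 * suc k + 1) → Fin (3 * suc k + 1)) →
    (a b : ℕ) →
    IsDominationNumber (Functigraph (Cycle (3 * suc k + 1)) f) a →
    IsDominationNumber (Cycle (3 * suc k + 1)) b →
    a < 2 * b
proposition4p1 k f a b γ-functigraph (γ-cycle , _) = begin-strict
  a                                ≤⟨ domination-number-≤ γ-functigraph functigraph-domSet ⟩
  length (everyThird m) + suc m    ≡⟨ cong (_+ suc m) (length-everyThird m) ⟩
  m + suc m                        <⟨ +-mono-<-≤ m<b m<b ⟩
  b + b                            ≡⟨ cong (b +_) (sym (+-identityʳ b)) ⟩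
  2 * b                            ∎
  where
  open ≤-Reasoning
  m n : ℕ
  m = suc k
  -- chosen so that suc n is definitionally 3 * suc k + 1
  n = k + 2 * m + 1
  n≡3m : n ≡ 3 * m
  n≡3m = +-comm (k + 2 * m) 1
  open CycleGraph n
  functigraph-domSet : HasDomSetOfSize (Functigraph (Cycle N) f) (length (everyThird m) + suc m)
  functigraph-domSet = HasDomSetOfSize-Functigraph (Cycle N) f (everyThird-unique {m} n≡3m)
    (everyThird-dominates-but-last {m} n≡3m)
    (HasDomSetOfSizeThrough-zero⇒∀ (HasDomSetOfSizeThrough-zero {m} n≡3m) (f (vertex n)))
  m<b : m < b
  m<b = HasDomSetOfSize⇒m<size {m} n≡3m γ-cycle
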